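{- For $n\ge1$ let $\mathrm{PQS}_n$ be the set of elements of $\mathrm{PQS}$ of length $n$. Then $|\mathrm{PQS}_n|$ is the large Schröder number $r_{n-1}$, i.e. $$\sum_{n\ge1}|\mathrm{PQS}_n|\,t^n=\frac{1-t-\sqrt{1-6t+t^2}}{2}=t+2t^2+6t^3+22t^4+\cdots.$$
   Context: A parking function of length $n$ is a word over $\{1,\dots,n\}$ whose nondecreasing rearrangement $a'_1\le\dots\le a'_n$ satisfies $a'_i\le i$. $\mathrm{Std}(w)$ is the standardization of a word $w$ (label $1,2,\dots$ from left to right the occurrences of the smallest letter, then of the next one, etc.). The hypoplactic congruence: $u\equiv v$ iff $u,v$ have the same multiset of letters and $\mathrm{Std}(u)^{ -1},\mathrm{Std}(v)^{ -1}$ have the same descent set. The hypoplactic class of a parking function consists of parking functions. The code of such a class $C$ is the common nondecreasing rearrangement of its elements with a vertical bar inserted between two consecutive distinct letters $x<y$ iff in some (equivalently every) element of $C$ an occurrence of $y$ precedes an occurrence of $x$. For codes $q,q'$ with $|q|=k$, $q\bullet q'$ is $q$ followed, with no bar in between, by $q'$ with $k$ added to each letter. $\mathrm{PQS}$ is the set of nonempty codes not of the form $q\bullet q'$ with $q,q'$ nonempty. Large Schröder numbers: $r_0,r_1,r_2,\dots=1,2,6,22,90,\dots$. -}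

module Defs where

open import Data.Nat using (ℕ; zero; suc; _+_; _*_; _≤_; _<ᵇ_; _≤ᵇ_; _≡ᵇ_)
open import Data.Bool using (Bool; true; false; if_then_else_; _∧_)
open import Data.List using (List; []; _∷_; length; lookup; map; _++_; zipWith; reverse)
open import Data.Bool.ListAction using (any)
open import Data.Nat.ListAction using (sum)
open import Data.List.Relation.Unary.All using (All)
open import Data.Fin using (Fin; toℕ)
open import Data.Product using (Σ; _×_; _,_)
open import Relation.Binary.PropositionalEquality using (_≡_; _≢_)
open import Relation.Nullary using (¬_)

Word : Set
Word = List ℕ

insert : ℕ → List ℕ → List ℕ
insert x [] = x ∷ []
insert x (y ∷ ys) = if x ≤ᵇ y then x ∷ y ∷ ys else y ∷ insert x ys

sort : List ℕ → List ℕ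
sort [] = []
sort (x ∷ xs) = insert x (sort xs)

IsParking : Word → Set
IsParking w =
  All (λ a → 1 ≤ a × a ≤ length w) w ×
  ((i : Fin (length (sort w))) → lookup (sort w) i ≤ suc (toℕ i))

yBeforeX : ℕ → ℕ → Word → Bool
yBeforeX y x [] = false
yBeforeX y x (a ∷ as) =
  if a ≡ᵇ y then any (λ b → b ≡ᵇ x) as else yBeforeX y x as

-- A code: the nondecreasing word, each letter paired with a flag saying
-- whether a vertical bar is placed immediately after it.
Code : Set
Code = List (ℕ × Bool)

mkBars : Word → List ℕ → Code
mkBars w [] = []
mkBars w (a ∷ []) = (a , false) ∷ []
mkBars w (a ∷ b ∷ rest) = (a , ((a <ᵇ b) ∧ yBeforeX b a w)) ∷ mkBars w (b ∷ rest)

-- the code of the hypoplactic class of w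
code : Word → Code
code w = mkBars w (sort w)

IsCode : Code → Set
IsCode q = Σ Word (λ w → IsParking w × code w ≡ q)

clearLast : Code → Code
clearLast [] = []
clearLast ((a , b) ∷ []) = (a , false) ∷ []
clearLast (p ∷ p' ∷ ps) = p ∷ clearLast (p' ∷ ps)

shift : ℕ → Code → Code
shift k = map (λ { (a , b) → (k + a , b) })

_•_ : Code → Code → Code
q • q' = clearLast q ++ shift (length q) q'

Decomposable : Code → Set
Decomposable q =
  Σ Code (λ q₁ → Σ Code (λ q₂ →
    IsCode q₁ × IsCode q₂ × q₁ ≢ [] × q₂ ≢ [] × q ≡ q₁ • q₂))

PQS : Code → Set
PQS q = IsCode q × q ≢ [] × ¬ Decomposable q

-- Large Schröder numbers r_0, r_1, … = 1, 2, 6, 22, 90, …, via the recurrence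
-- r_{n+1} = r_n + Σ_{k=0}^{n} r_k r_{n-k}, equivalent to the generating
-- function R(t) = Σ r_n t^n satisfying R = 1 + t R + t R², i.e.
-- t R(t) = (1 - t - √(1 - 6t + t²)) / 2.
-- schroderRev n = [r_n, r_{n-1}, …, r_0]
schroderRev : ℕ → List ℕ
schroderRev zero = 1 ∷ []
schroderRev (suc n) with schroderRev n
... | [] = []
... | (r ∷ rs) = (r + sum (zipWith _*_ (r ∷ rs) (reverse (r ∷ rs)))) ∷ r ∷ rs

schroder : ℕ → ℕ
schroder n with schroderRev n
... | [] = 0
... | (r ∷ _) = r

-- A code is a nondecreasing parking word 1 = a₁ ≤ … ≤ aₙ (aᵢ ≤ i) with bars at an
-- arbitrary set of strict ascents.  It factors as q₁ • q₂ exactly at a letter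
-- aₖ₊₁ = k + 1 with no bar before it, so the PQS codes are those in which every such
-- letter is barred off.  In terms of the slack eᵢ = i ∸ aᵢ, a PQS code moves from
-- slack e to slack e + 1 without a bar, to slack 0 with a bar, or to any slack in
-- 1 … e with or without a bar.  These are exactly the moves of a stack of e + 1
-- Schröder trees under popping (discard leaves, then replace a unary or binary node
-- by its children), which gives a bijection between PQS codes of length n + 1 and
-- Schröder trees with n internal nodes, counted by rₙ₊₁ = rₙ + Σₖ rₖ rₙ₋ₖ.

module Submission where

open import Defs
open import Data.Nat using (ℕ; zero; suc; _+_; _*_; _∸_; _≤_; _<_; z≤n; s≤s; _≤ᵇ_; _<ᵇ_; _≡ᵇ_)
open import Data.Nat.Properties
open import Data.Nat.Induction using (<-rec)
open import Data.Nat.ListAction using (sum)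
open import Data.Nat.Tactic.RingSolver using (solve-∀)
open import Data.Bool using (Bool; true; false; _∧_; not; T)
open import Data.Bool.Properties using (∨-zeroʳ)
open import Data.Bool.ListAction using (any)
open import Data.List
  using ( List; []; _∷_; length; lookup; map; _++_; _∷ʳ_; concat; zipWith; reverse; replicate
        ; cartesianProductWith; applyUpTo; downFrom; upTo )
open import Data.List.Properties
  using ( length-++; length-map; length-replicate; zipWith-map; reverse-map; reverse-downFrom
        ; ∷-injective; ∷-injectiveˡ )
open import Data.List.Relation.Unary.All as All using (All; []; _∷_)
import Data.List.Relation.Unary.All.Properties as All
open import Data.List.Relation.Unary.AllPairs using (AllPairs; []; _∷_)
import Data.List.Relation.Unary.AllPairs.Properties as AllPairs
open import Data.List.Relation.Unary.Any using (here; there)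
open import Data.List.Membership.Propositional using (_∈_)
open import Data.List.Membership.Propositional.Properties
open import Data.List.Relation.Unary.Unique.Propositional using (Unique)
open import Data.List.Relation.Binary.Disjoint.Propositional using (Disjoint)
import Data.List.Relation.Unary.Unique.Propositional.Properties as Unique
open import Data.Fin using (Fin; toℕ) renaming (zero to fzero; suc to fsuc)
open import Data.Fin.Properties using (toℕ<n)
open import Data.Product using (Σ; ∃; _×_; _,_; proj₁; proj₂)
open import Data.Sum using (_⊎_; inj₁; inj₂)
open import Data.Empty using (⊥; ⊥-elim)
open import Data.Unit using (tt)
open import Function using (_∘_; _∘′_; _$_)
open import Function.Bundles using (_⇔_; mk⇔; Equivalence)
open import Relation.Binary.PropositionalEquality
open import Relation.Nullary using (¬_; yes; no; contradiction)

≤⇒≤ᵇ≡true : ∀ {m n} → m ≤ n → (m ≤ᵇ n) ≡ true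
≤⇒≤ᵇ≡true {m} {n} m≤n with m ≤ᵇ n | ≤⇒≤ᵇ m≤n
... | true | _ = refl

>⇒≤ᵇ≡false : ∀ {m n} → n < m → (m ≤ᵇ n) ≡ false
>⇒≤ᵇ≡false {m} {n} n<m with m ≤ᵇ n | ≤ᵇ⇒≤ m n
... | false | _ = refl
... | true | m≤n = contradiction (m≤n tt) (<⇒≱ n<m)

<⇒<ᵇ≡true : ∀ {m n} → m < n → (m <ᵇ n) ≡ true
<⇒<ᵇ≡true {m} {n} m<n with m <ᵇ n | <⇒<ᵇ m<n
... | true | _ = refl

<ᵇ≡true⇒< : ∀ {m n} → (m <ᵇ n) ≡ true → m < n
<ᵇ≡true⇒< {m} {n} eq = <ᵇ⇒< m n (subst T (sym eq) tt)

≢⇒≡ᵇ≡false : ∀ {m n} → m ≢ n → (m ≡ᵇ n) ≡ false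
≢⇒≡ᵇ≡false {m} {n} m≢n with m ≡ᵇ n | ≡ᵇ⇒≡ m n
... | false | _ = refl
... | true | m≡n = contradiction (m≡n tt) m≢n

≡ᵇ-refl : ∀ n → (n ≡ᵇ n) ≡ true
≡ᵇ-refl zero = refl
≡ᵇ-refl (suc n) = ≡ᵇ-refl n

≡⇒≡ᵇ≡true : ∀ {m n} → m ≡ n → (m ≡ᵇ n) ≡ true
≡⇒≡ᵇ≡true {m} refl = ≡ᵇ-refl m

not-≡ᵇ≡true⇒≢ : ∀ {m n} → not (m ≡ᵇ n) ≡ true → m ≢ n
not-≡ᵇ≡true⇒≢ t m≡n with subst (λ b → not b ≡ true) (≡⇒≡ᵇ≡true m≡n) t
... | ()

-- Sorting

Sorted : List ℕ → Set
Sorted = AllPairs _≤_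

insert-All : ∀ {P : ℕ → Set} x xs → P x → All P xs → All P (insert x xs)
insert-All x [] px [] = px ∷ []
insert-All x (y ∷ ys) px (py ∷ pys) with x ≤ᵇ y
... | true = px ∷ py ∷ pys
... | false = py ∷ insert-All x ys px pys

insert-sorted : ∀ x xs → Sorted xs → Sorted (insert x xs)
insert-sorted x [] [] = [] ∷ []
insert-sorted x (y ∷ ys) (y≤ys ∷ ys↑) with x ≤? y
... | yes x≤y rewrite ≤⇒≤ᵇ≡true x≤y = (x≤y ∷ All.map (≤-trans x≤y) y≤ys) ∷ y≤ys ∷ ys↑
... | no x≰y rewrite >⇒≤ᵇ≡false (≰⇒> x≰y) =
  insert-All x ys (<⇒≤ (≰⇒> x≰y)) y≤ys ∷ insert-sorted x ys ys↑

sort-sorted : ∀ xs → Sorted (sort xs)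
sort-sorted [] = []
sort-sorted (x ∷ xs) = insert-sorted x (sort xs) (sort-sorted xs)

sort-All : ∀ {P : ℕ → Set} xs → All P xs → All P (sort xs)
sort-All [] [] = []
sort-All (x ∷ xs) (px ∷ pxs) = insert-All x (sort xs) px (sort-All xs pxs)

insert-≤-head : ∀ {x y} ys → x ≤ y → insert x (y ∷ ys) ≡ x ∷ y ∷ ys
insert-≤-head ys x≤y rewrite ≤⇒≤ᵇ≡true x≤y = refl

sort-∷ʳ-minimum : ∀ x ys → All (x <_) ys → sort (ys ∷ʳ x) ≡ x ∷ sort ys
sort-∷ʳ-minimum x [] [] = refl
sort-∷ʳ-minimum x (y ∷ ys) (x<y ∷ x<ys)
  rewrite sort-∷ʳ-minimum x ys x<ys | >⇒≤ᵇ≡false x<y = refl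

-- Codes

-- In  CodeTail e a f q  the letter a carries the bar f and has slack e, the amount
-- by which its position exceeds it; q is the rest of the code.
LegalStep : ℕ → ℕ → Bool → ℕ → Set
LegalStep e a f b = a ≤ b × b ≤ suc e + a × (f ≡ true → a < b)

CodeTail : ℕ → ℕ → Bool → Code → Set
CodeTail e a f [] = f ≡ false
CodeTail e a f ((b , g) ∷ q) = LegalStep e a f b × CodeTail (suc e + a ∸ b) b g q

CodeShape : Code → Set
CodeShape [] = ⊥
CodeShape ((a , f) ∷ q) = a ≡ 1 × CodeTail 0 a f q

letters : Code → List ℕ
letters = map proj₁

codeTail-≤ : ∀ {e a f} q → CodeTail e a f q → All (a ≤_) (letters q)
codeTail-≤ [] _ = []
codeTail-≤ ((b , g) ∷ q) ((a≤b , _) , tail) = a≤b ∷ All.map (≤-trans a≤b) (codeTail-≤ q tail)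

codeTail-< : ∀ {e a} q → CodeTail e a true q → All (a <_) (letters q)
codeTail-< ((b , g) ∷ q) ((_ , _ , a<b) , tail) =
  a<b refl ∷ All.map (<-≤-trans (a<b refl)) (codeTail-≤ q tail)

codeTail-lookup-≤ : ∀ {e a f} q → CodeTail e a f q →
                    ∀ i → lookup (a ∷ letters q) i ≤ e + a + toℕ i
codeTail-lookup-≤ {e} {a} q tail fzero = ≤-trans (m≤n+m a e) (m≤m+n (e + a) 0)
codeTail-lookup-≤ {e} {a} ((b , g) ∷ q) ((_ , b≤ , _) , tail) (fsuc i) =
  subst (lookup (b ∷ letters q) i ≤_) slack-+-suc (codeTail-lookup-≤ q tail i)
  where
  slack-+-suc : (suc e + a ∸ b) + b + toℕ i ≡ e + a + suc (toℕ i)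
  slack-+-suc = trans (cong (_+ toℕ i) (m∸n+n≡m b≤)) (sym (+-suc (e + a) (toℕ i)))

barAfter : Word → ℕ → List ℕ → Bool
barAfter w a [] = false
barAfter w a (b ∷ _) = (a <ᵇ b) ∧ yBeforeX b a w

mkBars-∷ : ∀ w a s → mkBars w (a ∷ s) ≡ (a , barAfter w a s) ∷ mkBars w s
mkBars-∷ w a [] = refl
mkBars-∷ w a (b ∷ s) = refl

mkBars-codeTail : ∀ w p a s → Sorted (a ∷ s) → (∀ i → lookup (a ∷ s) i ≤ p + toℕ i) →
                  CodeTail (p ∸ a) a (barAfter w a s) (mkBars w s)
mkBars-codeTail w p a [] _ _ = refl
mkBars-codeTail w p a (b ∷ s) ((a≤b ∷ _) ∷ s↑) bound rewrite mkBars-∷ w b s =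
  (a≤b , b≤ , bar⇒< ) ,
  subst (λ e → CodeTail e b (barAfter w b s) (mkBars w s)) (cong (_∸ b) (sym p+1))
        (mkBars-codeTail w (suc p) b s s↑ bound′)
  where
  a≤p : a ≤ p
  a≤p = subst (a ≤_) (+-identityʳ p) (bound fzero)
  p+1 : suc (p ∸ a) + a ≡ suc p
  p+1 = cong suc (m∸n+n≡m a≤p)
  b≤ : b ≤ suc (p ∸ a) + a
  b≤ = subst (b ≤_) (trans (+-comm p 1) (sym p+1)) (bound (fsuc fzero))
  bar⇒< : (a <ᵇ b) ∧ yBeforeX b a w ≡ true → a < b
  bar⇒< eq with a <ᵇ b in a<ᵇb
  ... | true = <ᵇ≡true⇒< a<ᵇb
  bound′ : ∀ i → lookup (b ∷ s) i ≤ suc p + toℕ i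
  bound′ i = subst (lookup (b ∷ s) i ≤_) (+-suc p (toℕ i)) (bound (fsuc i))

isCode⇒codeShape : ∀ q → IsCode q → q ≡ [] ⊎ CodeShape q
isCode⇒codeShape q (w , (inRange , parking) , refl)
  with sort w | sort-sorted w | sort-All w (All.map proj₁ inRange) | parking
... | [] | _ | _ | _ = inj₁ refl
... | a ∷ s | s↑ | 1≤a ∷ _ | parking′ rewrite mkBars-∷ w a s
  with ≤-antisym (parking′ fzero) 1≤a
... | refl = inj₂ (refl , mkBars-codeTail w 1 1 s s↑ parking′)

yBeforeX-∷ : ∀ {c y x} w → c ≢ y → yBeforeX y x (c ∷ w) ≡ yBeforeX y x w
yBeforeX-∷ w c≢y rewrite ≢⇒≡ᵇ≡false c≢y = refl

any-≡ᵇ-∷ʳ : ∀ {c x} w → c ≢ x → any (_≡ᵇ x) (w ∷ʳ c) ≡ any (_≡ᵇ x) w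
any-≡ᵇ-∷ʳ [] c≢x rewrite ≢⇒≡ᵇ≡false c≢x = refl
any-≡ᵇ-∷ʳ (d ∷ w) c≢x rewrite any-≡ᵇ-∷ʳ w c≢x = refl

yBeforeX-∷ʳ : ∀ {c y x} w → c ≢ x → yBeforeX y x (w ∷ʳ c) ≡ yBeforeX y x w
yBeforeX-∷ʳ {c} {y} [] c≢x with c ≡ᵇ y
... | true = refl
... | false = refl
yBeforeX-∷ʳ {c} {y} (d ∷ w) c≢x with d ≡ᵇ y
... | true = any-≡ᵇ-∷ʳ w c≢x
... | false = yBeforeX-∷ʳ w c≢x

any-≡ᵇ-absent : ∀ {x} w → All (x <_) w → any (_≡ᵇ x) w ≡ false
any-≡ᵇ-absent [] [] = refl
any-≡ᵇ-absent (d ∷ w) (x<d ∷ x<w)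
  rewrite ≢⇒≡ᵇ≡false (≢-sym (<⇒≢ x<d)) | any-≡ᵇ-absent w x<w = refl

yBeforeX-absent : ∀ {y x} w → All (x <_) w → yBeforeX y x w ≡ false
yBeforeX-absent [] [] = refl
yBeforeX-absent {y} (d ∷ w) (_ ∷ x<w) with d ≡ᵇ y
... | true = any-≡ᵇ-absent w x<w
... | false = yBeforeX-absent w x<w

any-≡ᵇ-∷ʳ-self : ∀ x w → any (_≡ᵇ x) (w ∷ʳ x) ≡ true
any-≡ᵇ-∷ʳ-self x [] rewrite ≡ᵇ-refl x = refl
any-≡ᵇ-∷ʳ-self x (d ∷ w) rewrite any-≡ᵇ-∷ʳ-self x w = ∨-zeroʳ _

yBeforeX-∷ʳ-self : ∀ {y x} w → y ∈ w → yBeforeX y x (w ∷ʳ x) ≡ true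
yBeforeX-∷ʳ-self {y} {x} (d ∷ w) y∈ with d ≡ᵇ y in d≡ᵇy | y∈
... | true | _ = any-≡ᵇ-∷ʳ-self x w
... | false | here refl = contradiction (trans (sym d≡ᵇy) (≡ᵇ-refl d)) λ ()
... | false | there y∈w = yBeforeX-∷ʳ-self w y∈w

-- A letter carrying a bar is moved behind all the larger letters that follow
-- it; this creates exactly the inversions recorded by the bars.
canonicalWord : Code → Word
canonicalWord [] = []
canonicalWord ((a , false) ∷ q) = a ∷ canonicalWord q
canonicalWord ((a , true) ∷ q) = canonicalWord q ∷ʳ a

canonicalWord-All : ∀ {P : ℕ → Set} q → All P (letters q) → All P (canonicalWord q)
canonicalWord-All [] [] = []
canonicalWord-All ((a , false) ∷ q) (pa ∷ pq) = pa ∷ canonicalWord-All q pq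
canonicalWord-All ((a , true) ∷ q) (pa ∷ pq) = All.++⁺ (canonicalWord-All q pq) (pa ∷ [])

∈-canonicalWord : ∀ a f q → a ∈ canonicalWord ((a , f) ∷ q)
∈-canonicalWord a false q = here refl
∈-canonicalWord a true q = ∈-++⁺ʳ (canonicalWord q) (here refl)

length-canonicalWord : ∀ q → length (canonicalWord q) ≡ length q
length-canonicalWord [] = refl
length-canonicalWord ((a , false) ∷ q) = cong suc (length-canonicalWord q)
length-canonicalWord ((a , true) ∷ q) =
  trans (length-++ (canonicalWord q)) (trans (+-comm _ 1) (cong suc (length-canonicalWord q)))

sort-canonicalWord : ∀ {e} a f q → CodeTail e a f q →
                     sort (canonicalWord ((a , f) ∷ q)) ≡ a ∷ letters q
sort-canonicalWord a false [] tail = refl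
sort-canonicalWord a false ((b , g) ∷ q) ((a≤b , _) , tail)
  rewrite sort-canonicalWord b g q tail = insert-≤-head (letters q) a≤b
sort-canonicalWord a true (p@(b , g) ∷ q) tail@(_ , tail′)
  rewrite sort-∷ʳ-minimum a (canonicalWord (p ∷ q))
            (canonicalWord-All (p ∷ q) (codeTail-< (p ∷ q) tail))
        | sort-canonicalWord b g q tail′ = refl

BarsAgree : Word → ℕ → Bool → Code → Set
BarsAgree w a f [] = f ≡ false
BarsAgree w a f ((b , g) ∷ q) = barAfter w a (b ∷ []) ≡ f × BarsAgree w b g q

mkBars-agree : ∀ w a f q → BarsAgree w a f q → mkBars w (a ∷ letters q) ≡ (a , f) ∷ q
mkBars-agree w a f [] refl = refl
mkBars-agree w a f ((b , g) ∷ q) (bar , agree) =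
  cong₂ _∷_ (cong (a ,_) bar) (mkBars-agree w b g q agree)

BarsAgree-∷ : ∀ {c} w a f q → All (c ≤_) (a ∷ letters q) →
              BarsAgree w a f q → BarsAgree (c ∷ w) a f q
BarsAgree-∷ w a f [] _ agree = agree
BarsAgree-∷ {c} w a f ((b , g) ∷ q) (c≤a ∷ c≤q) (bar , agree) =
  bar′ , BarsAgree-∷ w b g q c≤q agree
  where
  bar′ : ((a <ᵇ b) ∧ yBeforeX b a (c ∷ w)) ≡ f
  bar′ with a <ᵇ b in a<ᵇb
  ... | false = bar
  ... | true rewrite yBeforeX-∷ {c} {b} {a} w (<⇒≢ (≤-<-trans c≤a (<ᵇ≡true⇒< a<ᵇb))) = bar

BarsAgree-∷ʳ : ∀ {c} w a f q → All (c <_) (a ∷ letters q) →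
               BarsAgree w a f q → BarsAgree (w ∷ʳ c) a f q
BarsAgree-∷ʳ w a f [] _ agree = agree
BarsAgree-∷ʳ {c} w a f ((b , g) ∷ q) (c<a ∷ c<q) (bar , agree) =
  trans (cong ((a <ᵇ b) ∧_) (yBeforeX-∷ʳ {c} {b} {a} w (<⇒≢ c<a))) bar ,
  BarsAgree-∷ʳ w b g q c<q agree

canonicalWord-barsAgree : ∀ {e} a f q → CodeTail e a f q →
                          BarsAgree (canonicalWord ((a , f) ∷ q)) a f q
canonicalWord-barsAgree a f [] tail = tail
canonicalWord-barsAgree a false (p@(b , g) ∷ q) ((a≤b , _) , tail) =
  noBar , BarsAgree-∷ _ b g q (a≤b ∷ All.map (≤-trans a≤b) (codeTail-≤ q tail))
                              (canonicalWord-barsAgree b g q tail)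
  where
  noBar : ((a <ᵇ b) ∧ yBeforeX b a (a ∷ canonicalWord (p ∷ q))) ≡ false
  noBar with a <ᵇ b in a<ᵇb
  ... | false = refl
  ... | true
    rewrite yBeforeX-∷ {a} {b} {a} (canonicalWord (p ∷ q)) (<⇒≢ (<ᵇ≡true⇒< a<ᵇb)) =
    yBeforeX-absent (canonicalWord (p ∷ q)) (canonicalWord-All (p ∷ q)
      (<ᵇ≡true⇒< a<ᵇb ∷ All.map (<-≤-trans (<ᵇ≡true⇒< a<ᵇb)) (codeTail-≤ q tail)))
canonicalWord-barsAgree a true (p@(b , g) ∷ q) tail@((_ , _ , a<b) , tail′) =
  bar , BarsAgree-∷ʳ _ b g q (codeTail-< (p ∷ q) tail) (canonicalWord-barsAgree b g q tail′)
  where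
  bar : ((a <ᵇ b) ∧ yBeforeX b a (canonicalWord (p ∷ q) ∷ʳ a)) ≡ true
  bar rewrite <⇒<ᵇ≡true (a<b refl)
            | yBeforeX-∷ʳ-self {b} {a} (canonicalWord (p ∷ q)) (∈-canonicalWord b g q) = refl

lookup-≤⇒All : ∀ {N} xs → (∀ i → lookup xs i ≤ N) → All (_≤ N) xs
lookup-≤⇒All [] _ = []
lookup-≤⇒All (x ∷ xs) bound = bound fzero ∷ lookup-≤⇒All xs (λ i → bound (fsuc i))

codeShape⇒isCode : ∀ q → CodeShape q → IsCode q
codeShape⇒isCode ((a , f) ∷ q) (refl , tail) = w , (inRange , parking) , code-w
  where
  w = canonicalWord ((1 , f) ∷ q)
  sort-w : sort w ≡ 1 ∷ letters q
  sort-w = sort-canonicalWord 1 f q tail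
  bound : ∀ i → lookup (1 ∷ letters q) i ≤ suc (toℕ i)
  bound = codeTail-lookup-≤ q tail
  length-w : length (1 ∷ letters q) ≡ length w
  length-w = trans (cong suc (length-map proj₁ q)) (sym (length-canonicalWord ((1 , f) ∷ q)))
  inRange : All (λ c → 1 ≤ c × c ≤ length w) w
  inRange = canonicalWord-All ((1 , f) ∷ q) (All.zip
    ( s≤s z≤n ∷ codeTail-≤ q tail
    , lookup-≤⇒All _ (λ i → ≤-trans (bound i) (subst (suc (toℕ i) ≤_) length-w (toℕ<n i)))))
  parking : (i : Fin (length (sort w))) → lookup (sort w) i ≤ suc (toℕ i)
  parking rewrite sort-w = bound
  code-w : code w ≡ (1 , f) ∷ q
  code-w rewrite sort-w = mkBars-agree w 1 f q (canonicalWord-barsAgree 1 f q tail)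

-- Indecomposable codes

-- A code splits as q₁ • q₂ exactly where a letter returns to slack 0 with no bar
-- before it.
PQSTail : ℕ → ℕ → Bool → Code → Set
PQSTail e a f [] = f ≡ false
PQSTail e a f ((b , g) ∷ q) =
  LegalStep e a f b × (b ≡ suc e + a → f ≡ true) × PQSTail (suc e + a ∸ b) b g q

PQSTailFrom : ℕ → Code → Set
PQSTailFrom e [] = ⊥
PQSTailFrom e ((a , f) ∷ q) = PQSTail e a f q

PQSShape : Code → Set
PQSShape [] = ⊥
PQSShape ((a , f) ∷ q) = a ≡ 1 × PQSTail 0 a f q

PQSTail⇒CodeTail : ∀ {e a f} q → PQSTail e a f q → CodeTail e a f q
PQSTail⇒CodeTail [] tail = tail
PQSTail⇒CodeTail ((b , g) ∷ q) (step , _ , tail) = step , PQSTail⇒CodeTail q tail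

clearLast-codeTail : ∀ {e} a f q → CodeTail e a f q → clearLast ((a , f) ∷ q) ≡ (a , f) ∷ q
clearLast-codeTail a .false [] refl = refl
clearLast-codeTail a f ((b , g) ∷ q) (_ , tail) = cong ((a , f) ∷_) (clearLast-codeTail b g q tail)

slack-step : ∀ e a b k → b ≤ suc e + a → suc (e + a + suc k) ≡ suc ((suc e + a ∸ b) + b + k)
slack-step e a b k b≤ = cong suc (trans (+-suc (e + a) k) (sym (cong (_+ k) (m∸n+n≡m b≤))))

unbarredReturn-¬PQSTail : ∀ {e a f} R c g Z → CodeTail e a f R → c ≡ suc (e + a + length R) →
                          ¬ PQSTail e a f (R ++ (c , g) ∷ Z)
unbarredReturn-¬PQSTail {e} {a} [] c g Z refl c≡ (_ , returnBarred , _)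
  with returnBarred (trans c≡ (cong suc (+-identityʳ (e + a))))
... | ()
unbarredReturn-¬PQSTail {e} {a} ((b , h) ∷ R) c g Z ((_ , b≤ , _) , tail) c≡ (_ , _ , tail′) =
  unbarredReturn-¬PQSTail R c g Z tail (trans c≡ (slack-step e a b (length R) b≤)) tail′

PQSShape⇒¬Decomposable : ∀ q → PQSShape q → ¬ Decomposable q
PQSShape⇒¬Decomposable q pqs (q₁ , q₂ , code₁ , code₂ , q₁≢[] , q₂≢[] , refl)
  with isCode⇒codeShape q₁ code₁ | isCode⇒codeShape q₂ code₂
... | inj₁ q₁≡[] | _ = q₁≢[] q₁≡[]
... | inj₂ _ | inj₁ q₂≡[] = q₂≢[] q₂≡[]
... | inj₂ shape₁ | inj₂ shape₂ = split q₁ q₂ shape₁ shape₂ pqs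
  where
  split : ∀ q₁ q₂ → CodeShape q₁ → CodeShape q₂ → ¬ PQSShape (q₁ • q₂)
  split ((_ , f) ∷ R) q₂@((_ , g) ∷ Z) (refl , tail) (refl , _) =
    unbarredReturn-¬PQSTail R _ g (shift k Z) tail (cong suc (+-comm (length R) 1)) ∘ proj₂
    ∘ subst PQSShape (cong (_++ shift k q₂) (clearLast-codeTail 1 f R tail))
    where k = suc (length R)

unshift : ℕ → Code → Code
unshift k = map λ { (a , f) → (a ∸ k , f) }

shift-unshift : ∀ k Z → All (k ≤_) (letters Z) → shift k (unshift k Z) ≡ Z
shift-unshift k [] [] = refl
shift-unshift k ((a , f) ∷ Z) (k≤a ∷ k≤Z) =
  cong₂ _∷_ (cong (_, f) (m+[n∸m]≡n k≤a)) (shift-unshift k Z k≤Z)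

codeTail-shift⁻ : ∀ k {e x g} Z → CodeTail e (k + x) g (shift k Z) → CodeTail e x g Z
codeTail-shift⁻ k [] tail = tail
codeTail-shift⁻ k {e} {x} ((b , h) ∷ Z) ((k+x≤ , ≤slack , bar⇒<) , tail) =
  ( +-cancelˡ-≤ k x b k+x≤
  , +-cancelˡ-≤ k b (suc e + x) (subst (k + b ≤_) (+-comm-middle e k x) ≤slack)
  , (λ bar → +-cancelˡ-< k x b (bar⇒< bar)) ) ,
  codeTail-shift⁻ k Z (subst (λ s → CodeTail s (k + b) h (shift k Z)) slack-eq tail)
  where
  +-comm-middle : ∀ e k x → suc e + (k + x) ≡ k + (suc e + x)
  +-comm-middle = solve-∀
  slack-eq : suc e + (k + x) ∸ (k + b) ≡ suc e + x ∸ b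
  slack-eq = trans (cong (_∸ (k + b)) (+-comm-middle e k x)) ([m+n]∸[m+o]≡n∸o k (suc e + x) b)

IndecomposableTail : ℕ → ℕ → Bool → Code → Set
IndecomposableTail e a f X = ∀ R c g Z → X ≡ R ++ (c , g) ∷ Z → CodeTail e a f R →
                             c ≡ suc (e + a + length R) → ¬ CodeTail 0 c g Z

indecomposableTail⇒PQSTail : ∀ {e a f} X → CodeTail e a f X → IndecomposableTail e a f X →
                             PQSTail e a f X
indecomposableTail⇒PQSTail [] tail _ = tail
indecomposableTail⇒PQSTail {e} {a} {f} ((b , g) ∷ Y) (step@(_ , b≤ , _) , tail) indec =
  step , returnBarred indec , indecomposableTail⇒PQSTail Y tail indec′
  where
  returnBarred : ∀ {f} → IndecomposableTail e a f ((b , g) ∷ Y) → b ≡ suc e + a → f ≡ true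
  returnBarred {true} _ _ = refl
  returnBarred {false} indec refl = contradiction
    (subst (λ s → CodeTail s b g Y) (n∸n≡0 b) tail)
    (indec [] b g Y refl refl (cong suc (sym (+-identityʳ (e + a)))))
  indec′ : IndecomposableTail _ b g Y
  indec′ R c h Z refl tailR c≡ = indec ((b , g) ∷ R) c h Z refl (step , tailR)
    (trans c≡ (sym (slack-step e a b (length R) b≤)))

¬Decomposable⇒PQSShape : ∀ q → CodeShape q → ¬ Decomposable q → PQSShape q
¬Decomposable⇒PQSShape ((_ , f) ∷ X) (refl , tail) ¬dec =
  refl , indecomposableTail⇒PQSTail X tail indec
  where
  indec : IndecomposableTail 0 1 f X
  indec R c g Z refl tailR c≡ tailZ =
    ¬dec (q₁ , q₂ , codeShape⇒isCode q₁ (refl , tailR) , codeShape⇒isCode q₂ (refl , tailZ′) ,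
          (λ ()) , (λ ()) , q≡q₁•q₂)
    where
    k = suc (length R)
    q₁ = (1 , f) ∷ R
    q₂ = (1 , g) ∷ unshift k Z
    c≡k+1 : c ≡ k + 1
    c≡k+1 = trans c≡ (cong suc (+-comm 1 (length R)))
    k≤Z : All (k ≤_) (letters Z)
    k≤Z = All.map (≤-trans (subst (k ≤_) (sym c≡k+1) (m≤m+n k 1))) (codeTail-≤ Z tailZ)
    tailZ′ : CodeTail 0 1 g (unshift k Z)
    tailZ′ = codeTail-shift⁻ k (unshift k Z)
      (subst₂ (λ x Z → CodeTail 0 x g Z) c≡k+1 (sym (shift-unshift k Z k≤Z)) tailZ)
    q≡q₁•q₂ : (1 , f) ∷ R ++ (c , g) ∷ Z ≡ q₁ • q₂
    q≡q₁•q₂ rewrite clearLast-codeTail 1 f R tailR | shift-unshift k Z k≤Z | sym c≡k+1 = refl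

PQS⇒PQSShape : ∀ q → PQS q → PQSShape q
PQS⇒PQSShape q (isCode , q≢[] , ¬dec) with isCode⇒codeShape q isCode
... | inj₁ q≡[] = contradiction q≡[] q≢[]
... | inj₂ shape = ¬Decomposable⇒PQSShape q shape ¬dec

PQSShape⇒PQS : ∀ q → PQSShape q → PQS q
PQSShape⇒PQS q@((_ , _) ∷ X) pqs@(a≡1 , tail) =
  codeShape⇒isCode q (a≡1 , PQSTail⇒CodeTail X tail) , (λ ()) , PQSShape⇒¬Decomposable q pqs

-- Schröder trees

Enumerates : {A : Set} → List A → (A → Set) → Set
Enumerates xs P = Unique xs × (∀ x → x ∈ xs ⇔ P x)

map-enumerates : ∀ {A B : Set} {f : A → B} {xs : List A} {P : A → Set} {Q : B → Set} →
  (∀ {x y} → f x ≡ f y → x ≡ y) → Enumerates xs P → (∀ y → Q y ⇔ ∃ λ x → P x × f x ≡ y) →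
  Enumerates (map f xs) Q
map-enumerates {f = f} {xs} {Q = Q} f-injective (unique , mem) Q⇔ =
  Unique.map⁺ f-injective unique , λ y → mk⇔ (to y) (from y)
  where
  to : ∀ y → y ∈ map f xs → Q y
  to y y∈ with ∈-map⁻ f y∈
  ... | x , x∈ , refl = Equivalence.from (Q⇔ y) (x , Equivalence.to (mem x) x∈ , refl)
  from : ∀ y → Q y → y ∈ map f xs
  from y q with Equivalence.to (Q⇔ y) q
  ... | x , px , refl = ∈-map⁺ f (Equivalence.from (mem x) px)

data SchröderTree : Set where
  leaf : SchröderTree
  node₁ : SchröderTree → SchröderTree
  node₂ : SchröderTree → SchröderTree → SchröderTree

size : SchröderTree → ℕ
size leaf = 0
size (node₁ t) = suc (size t)
size (node₂ l r) = suc (size l + size r)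

node₁-injective : ∀ {t u} → node₁ t ≡ node₁ u → t ≡ u
node₁-injective refl = refl

node₂-injective : ∀ {l l′ r r′} → node₂ l r ≡ node₂ l′ r′ → l ≡ l′ × r ≡ r′
node₂-injective refl = refl , refl

node₂s : List SchröderTree → List SchröderTree → List SchröderTree
node₂s = cartesianProductWith node₂

-- From [Tₙ, …, T₀] the trees of size n + 1, following the recurrence of schroderRev.
grow : List (List SchröderTree) → List SchröderTree
grow [] = []
grow (T ∷ Ts) = map node₁ T ++ concat (zipWith node₂s (T ∷ Ts) (reverse (T ∷ Ts)))

treesDownFrom : ℕ → List (List SchröderTree)
treesDownFrom zero = (leaf ∷ []) ∷ []
treesDownFrom (suc n) = grow (treesDownFrom n) ∷ treesDownFrom n

trees : ℕ → List SchröderTree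
trees zero = leaf ∷ []
trees (suc n) = grow (treesDownFrom n)

treesDownFrom≡ : ∀ n → treesDownFrom n ≡ map trees (downFrom (suc n))
treesDownFrom≡ zero = refl
treesDownFrom≡ (suc n) = cong (trees (suc n) ∷_) (treesDownFrom≡ n)

length-node₂s : ∀ ls rs → length (node₂s ls rs) ≡ length ls * length rs
length-node₂s [] rs = refl
length-node₂s (l ∷ ls) rs =
  trans (length-++ (map (node₂ l) rs)) (cong₂ _+_ (length-map (node₂ l) rs) (length-node₂s ls rs))

length-concat : ∀ {A : Set} (xss : List (List A)) → length (concat xss) ≡ sum (map length xss)
length-concat [] = refl
length-concat (xs ∷ xss) = trans (length-++ xs) (cong (length xs +_) (length-concat xss))

map-length-zipWith-node₂s : ∀ Ls Rs →
  map length (zipWith node₂s Ls Rs) ≡ zipWith _*_ (map length Ls) (map length Rs)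
map-length-zipWith-node₂s [] Rs = refl
map-length-zipWith-node₂s (L ∷ Ls) [] = refl
map-length-zipWith-node₂s (L ∷ Ls) (R ∷ Rs) =
  cong₂ _∷_ (length-node₂s L R) (map-length-zipWith-node₂s Ls Rs)

length-grow : ∀ T Ts → let ls = map length (T ∷ Ts) in
              length (grow (T ∷ Ts)) ≡ length T + sum (zipWith _*_ ls (reverse ls))
length-grow T Ts = begin
  length (map node₁ T ++ concat Z)
    ≡⟨ length-++ (map node₁ T) ⟩
  length (map node₁ T) + length (concat Z)
    ≡⟨ cong₂ _+_ (length-map node₁ T) (length-concat Z) ⟩
  length T + sum (map length Z)
    ≡⟨ cong (λ z → length T + sum z) (map-length-zipWith-node₂s (T ∷ Ts) (reverse (T ∷ Ts))) ⟩
  length T + sum (zipWith _*_ ls (map length (reverse (T ∷ Ts))))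
    ≡⟨ cong (λ z → length T + sum (zipWith _*_ ls z)) (reverse-map length (T ∷ Ts)) ⟩
  length T + sum (zipWith _*_ ls (reverse ls)) ∎
  where
  open ≡-Reasoning
  Z = zipWith node₂s (T ∷ Ts) (reverse (T ∷ Ts))
  ls = map length (T ∷ Ts)

map-length-treesDownFrom : ∀ n → map length (treesDownFrom n) ≡ schroderRev n
map-length-treesDownFrom zero = refl
map-length-treesDownFrom (suc n)
  with treesDownFrom n | treesDownFrom≡ n | map-length-treesDownFrom n
... | _ | refl | ih rewrite sym ih =
  cong (_∷ map length (map trees (downFrom (suc n))))
       (length-grow (trees n) (map trees (downFrom n)))

length-trees : ∀ n → length (trees n) ≡ schroder n
length-trees n with map-length-treesDownFrom n
... | eq rewrite treesDownFrom≡ n | sym eq = refl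

node₂sOfRightSize : ℕ → ℕ → List SchröderTree
node₂sOfRightSize n k = node₂s (trees (n ∸ k)) (trees k)

downFrom≡applyUpTo : ∀ n → downFrom n ≡ applyUpTo (λ k → n ∸ suc k) n
downFrom≡applyUpTo zero = refl
downFrom≡applyUpTo (suc n) = cong (n ∷_) (downFrom≡applyUpTo n)

zipWith-applyUpTo : ∀ {A B C : Set} (g : A → B → C) f h n →
  zipWith g (applyUpTo f n) (applyUpTo h n) ≡ applyUpTo (λ k → g (f k) (h k)) n
zipWith-applyUpTo g f h zero = refl
zipWith-applyUpTo g f h (suc n) = cong (_ ∷_) (zipWith-applyUpTo g (f ∘ suc) (h ∘ suc) n)

trees-suc : ∀ n → trees (suc n) ≡
  map node₁ (trees n) ++ concat (applyUpTo (node₂sOfRightSize n) (suc n))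
trees-suc n rewrite treesDownFrom≡ n = cong (λ z → map node₁ (trees n) ++ concat z) pairsUp
  where
  open ≡-Reasoning
  D = downFrom (suc n)
  node₂sOfSizes = λ i j → node₂s (trees i) (trees j)
  pairsUp : zipWith node₂s (map trees D) (reverse (map trees D)) ≡
            applyUpTo (node₂sOfRightSize n) (suc n)
  pairsUp = begin
    zipWith node₂s (map trees D) (reverse (map trees D))
      ≡⟨ cong (zipWith node₂s (map trees D)) (sym (reverse-map trees D)) ⟩
    zipWith node₂s (map trees D) (map trees (reverse D))
      ≡⟨ cong (λ z → zipWith node₂s (map trees D) (map trees z)) (reverse-downFrom (suc n)) ⟩
    zipWith node₂s (map trees D) (map trees (upTo (suc n)))
      ≡⟨ zipWith-map node₂s trees trees D (upTo (suc n)) ⟩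
    zipWith node₂sOfSizes D (upTo (suc n))
      ≡⟨ cong (λ z → zipWith node₂sOfSizes z (upTo (suc n))) (downFrom≡applyUpTo (suc n)) ⟩
    zipWith node₂sOfSizes (applyUpTo (λ k → suc n ∸ suc k) (suc n)) (applyUpTo (λ k → k) (suc n))
      ≡⟨ zipWith-applyUpTo node₂sOfSizes (λ k → suc n ∸ suc k) (λ k → k) (suc n) ⟩
    applyUpTo (node₂sOfRightSize n) (suc n) ∎

∈-node₂sOfRightSize⁻ : ∀ n k {t} → t ∈ node₂sOfRightSize n k →
  ∃ λ l → ∃ λ r → l ∈ trees (n ∸ k) × r ∈ trees k × t ≡ node₂ l r
∈-node₂sOfRightSize⁻ n k = ∈-cartesianProductWith⁻ node₂ (trees (n ∸ k)) (trees k)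

∈-concat-applyUpTo⁻ : ∀ {A : Set} {v : A} f n → v ∈ concat (applyUpTo f n) →
                      ∃ λ k → k < n × v ∈ f k
∈-concat-applyUpTo⁻ f n v∈ with ∈-concat⁻′ (applyUpTo f n) v∈
... | _ , v∈xs , xs∈ with ∈-applyUpTo⁻ f xs∈
... | k , k<n , refl = k , k<n , v∈xs

module _ (n : ℕ) (E : ∀ {k} → k ≤ n → Enumerates (trees k) (λ t → size t ≡ k)) where

  private
    Node₂s = concat (applyUpTo (node₂sOfRightSize n) (suc n))

    mem : ∀ {k} → k ≤ n → ∀ t → t ∈ trees k ⇔ size t ≡ k
    mem = proj₂ ∘ E

    rightSize : ∀ {k t} → k ≤ n → t ∈ node₂sOfRightSize n k →
                ∃ λ l → ∃ λ r → size r ≡ k × t ≡ node₂ l r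
    rightSize {k} k≤n t∈ with ∈-node₂sOfRightSize⁻ n k t∈
    ... | l , r , _ , r∈ , t≡ = l , r , Equivalence.to (mem k≤n r) r∈ , t≡

    node₂sOfRightSize-disjoint : ∀ {i j} → i < j → j < suc n →
                                 Disjoint (node₂sOfRightSize n i) (node₂sOfRightSize n j)
    node₂sOfRightSize-disjoint i<j j<1+n (t∈i , t∈j)
      with rightSize (≤-trans (<⇒≤ i<j) (≤-pred j<1+n)) t∈i | rightSize (≤-pred j<1+n) t∈j
    ... | _ , _ , refl , refl | _ , _ , refl , eq = <⇒≢ i<j (cong size (proj₂ (node₂-injective eq)))

    node₁∉Node₂s : ∀ {t} → t ∈ map node₁ (trees n) → ¬ t ∈ Node₂s
    node₁∉Node₂s t∈₁ t∈₂
      with ∈-map⁻ node₁ t∈₁ | ∈-concat-applyUpTo⁻ (node₂sOfRightSize n) (suc n) t∈₂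
    ... | _ , _ , refl | _ , k<1+n , t∈k with rightSize (≤-pred k<1+n) t∈k
    ... | _ , _ , _ , ()

  grown-unique : Unique (map node₁ (trees n) ++ Node₂s)
  grown-unique = Unique.++⁺ (Unique.map⁺ node₁-injective (uniq ≤-refl))
    (Unique.concat⁺
      (All.applyUpTo⁺₁ _ (suc n) λ {k} k<1+n → Unique.cartesianProductWith⁺ node₂ node₂-injective
                                                  (uniq (m∸n≤m n k)) (uniq (≤-pred k<1+n)))
      (AllPairs.applyUpTo⁺₁ _ (suc n) node₂sOfRightSize-disjoint))
    λ (t∈₁ , t∈₂) → node₁∉Node₂s t∈₁ t∈₂
    where
    uniq : ∀ {k} → k ≤ n → Unique (trees k)
    uniq = proj₁ ∘ E

  grown-sound : ∀ t → t ∈ map node₁ (trees n) ++ Node₂s → size t ≡ suc n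
  grown-sound t t∈ with ∈-++⁻ (map node₁ (trees n)) t∈
  ... | inj₁ t∈₁ with ∈-map⁻ node₁ t∈₁
  ...   | u , u∈ , refl = cong suc (Equivalence.to (mem ≤-refl u) u∈)
  grown-sound t t∈ | inj₂ t∈₂ with ∈-concat-applyUpTo⁻ (node₂sOfRightSize n) (suc n) t∈₂
  ... | k , k<1+n , t∈k with ∈-node₂sOfRightSize⁻ n k t∈k
  ... | l , r , l∈ , r∈ , refl = cong suc (trans
    (cong₂ _+_ (Equivalence.to (mem (m∸n≤m n k) l) l∈) (Equivalence.to (mem (≤-pred k<1+n) r) r∈))
    (m∸n+n≡m (≤-pred k<1+n)))

  grown-complete : ∀ t → size t ≡ suc n → t ∈ map node₁ (trees n) ++ Node₂s
  grown-complete (node₁ t) size≡ =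
    ∈-++⁺ˡ (∈-map⁺ node₁ (Equivalence.from (mem ≤-refl t) (suc-injective size≡)))
  grown-complete (node₂ l r) size≡ = ∈-++⁺ʳ (map node₁ (trees n))
    (∈-concat⁺′ (∈-cartesianProductWith⁺ node₂ l∈ r∈)
                (∈-applyUpTo⁺ (node₂sOfRightSize n) (s≤s r≤n)))
    where
    sizes : size l + size r ≡ n
    sizes = suc-injective size≡
    r≤n : size r ≤ n
    r≤n = subst (size r ≤_) sizes (m≤n+m (size r) (size l))
    n∸r≡l : n ∸ size r ≡ size l
    n∸r≡l = trans (cong (_∸ size r) (sym sizes)) (m+n∸n≡m (size l) (size r))
    l∈ : l ∈ trees (n ∸ size r)
    l∈ = Equivalence.from (mem (m∸n≤m n (size r)) l) (sym n∸r≡l)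
    r∈ : r ∈ trees (size r)
    r∈ = Equivalence.from (mem r≤n r) refl

grow-enumerates : ∀ n → (∀ {k} → k ≤ n → Enumerates (trees k) (λ t → size t ≡ k)) →
                  Enumerates (trees (suc n)) (λ t → size t ≡ suc n)
grow-enumerates n E rewrite trees-suc n =
  grown-unique n E , λ t → mk⇔ (grown-sound n E t) (grown-complete n E t)

leaf∈ : ∀ t → size t ≡ 0 → t ∈ trees 0
leaf∈ leaf _ = here refl

trees-enumerates : ∀ n → Enumerates (trees n) (λ t → size t ≡ n)
trees-enumerates = <-rec _ λ where
  zero _ → ([] ∷ []) , λ t → mk⇔ (λ { (here refl) → refl }) (λ { size≡0 → leaf∈ t size≡0 })
  (suc n) ih → grow-enumerates n (ih ∘ s≤s)

-- Decoding stacks of trees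

Forest : Set
Forest = List SchröderTree

forestSize : Forest → ℕ
forestSize [] = 0
forestSize (t ∷ ts) = size t + forestSize ts

forestSize-node₂ : ∀ l r ts → forestSize (node₂ l r ∷ ts) ≡ suc (forestSize (r ∷ l ∷ ts))
forestSize-node₂ l r ts = swap (size l) (size r) (forestSize ts)
  where
  swap : ∀ a b s → suc (a + b + s) ≡ suc (b + (a + s))
  swap = solve-∀

-- Popping discards the leaves on top of the stack and replaces the first internal
-- node by its children; the number carried is the new stack length minus one.
data Popped : Set where
  exhausted : Popped
  popped₁ popped₂ : ℕ → Forest → Popped

pop : Forest → Popped
pop [] = exhausted
pop (leaf ∷ ts) = pop ts
pop (node₁ t ∷ ts) = popped₁ (length ts) (t ∷ ts)
pop (node₂ l r ∷ ts) = popped₂ (suc (length ts)) (r ∷ l ∷ ts)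

PopSpec : ℕ → ℕ → Popped → Set
PopSpec L s exhausted = s ≡ 0
PopSpec L s (popped₁ e′ ts) = e′ < L × length ts ≡ suc e′ × s ≡ suc (forestSize ts)
PopSpec L s (popped₂ e′ ts) = 0 < e′ × e′ ≤ L × length ts ≡ suc e′ × s ≡ suc (forestSize ts)

pop-spec : ∀ ts → PopSpec (length ts) (forestSize ts) (pop ts)
pop-spec [] = refl
pop-spec (leaf ∷ ts) with pop ts | pop-spec ts
... | exhausted | s≡0 = s≡0
... | popped₁ _ _ | e′< , rest = m<n⇒m<1+n e′< , rest
... | popped₂ _ _ | 0<e′ , e′≤ , rest = 0<e′ , m≤n⇒m≤1+n e′≤ , rest
pop-spec (node₁ t ∷ ts) = n<1+n _ , refl , refl
pop-spec (node₂ l r ∷ ts) = s≤s z≤n , ≤-refl , refl , forestSize-node₂ l r ts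

-- A stack of e + 1 trees encodes slack e; the popped stack encodes the slack e′
-- of the next letter, which therefore exceeds the current one by (e + 1) ∸ e′.
mutual
  decode : ℕ → ℕ → Forest → Code
  decode zero x ts = (x , false) ∷ []
  decode (suc n) x ts = decodePopped n x (length ts) (pop ts)

  decodePopped : ℕ → ℕ → ℕ → Popped → Code
  decodePopped n x L exhausted = (x , false) ∷ []
  decodePopped n x L (popped₁ e′ ts) = (x , (e′ ≡ᵇ 0)) ∷ decode n (x + (L ∸ e′)) ts
  decodePopped n x L (popped₂ e′ ts) = (x , not (e′ ≡ᵇ L)) ∷ decode n (x + (L ∸ e′)) ts

headLetter : Code → ℕ
headLetter [] = 0
headLetter ((a , _) ∷ _) = a

headLetter-decode : ∀ n x ts → headLetter (decode n x ts) ≡ x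
headLetter-decode zero x ts = refl
headLetter-decode (suc n) x ts with pop ts
... | exhausted = refl
... | popped₁ _ _ = refl
... | popped₂ _ _ = refl

length-decode : ∀ n x ts → forestSize ts ≡ n → length (decode n x ts) ≡ suc n
length-decode zero x ts _ = refl
length-decode (suc n) x ts size≡ with pop ts | pop-spec ts
... | exhausted | s≡0 = contradiction (trans (sym s≡0) size≡) 0≢1+n
... | popped₁ _ ts′ | _ , _ , s≡ =
  cong suc (length-decode n _ ts′ (suc-injective (trans (sym s≡) size≡)))
... | popped₂ _ ts′ | _ , _ , _ , s≡ =
  cong suc (length-decode n _ ts′ (suc-injective (trans (sym s≡) size≡)))

slack-after : ∀ e e′ x → e′ ≤ suc e → suc e + x ∸ (x + (suc e ∸ e′)) ≡ e′
slack-after e e′ x e′≤ =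
  trans (cong (_∸ (x + (suc e ∸ e′))) (+-comm (suc e) x))
        (trans ([m+n]∸[m+o]≡n∸o x (suc e) (suc e ∸ e′)) (m∸[m∸n]≡n e′≤))

nextLetter-PQSTail : ∀ {e e′ x f} q → e′ ≤ suc e → (f ≡ true → e′ ≢ suc e) →
                     (e′ ≡ 0 → f ≡ true) → PQSTailFrom e′ q →
                     headLetter q ≡ x + (suc e ∸ e′) → PQSTail e x f q
nextLetter-PQSTail {e} {e′} {x} ((_ , g) ∷ q) e′≤ bar⇒ return⇒ tail refl =
  (m≤m+n x d , y≤ , x<y) , return⇒ ∘′ returns , subst (λ s → PQSTail s (x + d) g q) (sym slack≡) tail
  where
  d = suc e ∸ e′
  y≤ : x + d ≤ suc e + x
  y≤ = subst (x + d ≤_) (+-comm x (suc e)) (+-monoʳ-≤ x (m∸n≤m (suc e) e′))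
  x<y : _ ≡ true → x < x + d
  x<y bar = subst (_< x + d) (+-identityʳ x) (+-monoʳ-< x (m<n⇒0<n∸m (≤∧≢⇒< e′≤ (bar⇒ bar))))
  slack≡ : suc e + x ∸ (x + d) ≡ e′
  slack≡ = slack-after e e′ x e′≤
  returns : x + d ≡ suc e + x → e′ ≡ 0
  returns y≡ = trans (sym slack≡) (trans (cong (suc e + x ∸_) y≡) (n∸n≡0 (suc e + x)))

decode-PQSTail : ∀ n x ts e → length ts ≡ suc e → forestSize ts ≡ n → PQSTailFrom e (decode n x ts)
decode-PQSTail zero x ts e _ _ = refl
decode-PQSTail (suc n) x ts e len≡ size≡ with pop ts | pop-spec ts
... | exhausted | s≡0 = contradiction (trans (sym s≡0) size≡) 0≢1+n
... | popped₁ e′ ts′ | e′< , len′ , s≡ rewrite len≡ =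
  nextLetter-PQSTail (decode n _ ts′) (<⇒≤ e′<) (λ _ → <⇒≢ e′<) (λ e′≡0 → ≡⇒≡ᵇ≡true e′≡0)
    (decode-PQSTail n _ ts′ e′ len′ (suc-injective (trans (sym s≡) size≡)))
    (headLetter-decode n _ ts′)
... | popped₂ e′ ts′ | 0<e′ , e′≤ , len′ , s≡ rewrite len≡ =
  nextLetter-PQSTail (decode n _ ts′) e′≤ not-≡ᵇ≡true⇒≢ (λ e′≡0 → contradiction e′≡0 (>⇒≢ 0<e′))
    (decode-PQSTail n _ ts′ e′ len′ (suc-injective (trans (sym s≡) size≡)))
    (headLetter-decode n _ ts′)

leaves : ℕ → Forest
leaves m = replicate m leaf

pop-leaves : ∀ m ts → pop (leaves m ++ ts) ≡ pop ts
pop-leaves zero ts = refl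
pop-leaves (suc m) ts = pop-leaves m ts

forestSize-leaves : ∀ m ts → forestSize (leaves m ++ ts) ≡ forestSize ts
forestSize-leaves zero ts = refl
forestSize-leaves (suc m) ts = forestSize-leaves m ts

length-leaves-++ : ∀ e ts → length ts ≤ suc e → length (leaves (suc e ∸ length ts) ++ ts) ≡ suc e
length-leaves-++ e ts len≤ =
  trans (length-++ (leaves (suc e ∸ length ts)))
        (trans (cong (_+ length ts) (length-replicate (suc e ∸ length ts))) (m∸n+n≡m len≤))

Unpop : ℕ → Popped → ℕ → Set
Unpop L p s = Σ Forest λ ts → length ts ≡ L × forestSize ts ≡ s × pop ts ≡ p

unpop₁ : ∀ e t ts → length ts ≤ e →
         Unpop (suc e) (popped₁ (length ts) (t ∷ ts)) (suc (forestSize (t ∷ ts)))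
unpop₁ e t ts len≤ =
  leaves (e ∸ length ts) ++ node₁ t ∷ ts , length-leaves-++ e (node₁ t ∷ ts) (s≤s len≤) ,
  forestSize-leaves (e ∸ length ts) (node₁ t ∷ ts) , pop-leaves (e ∸ length ts) (node₁ t ∷ ts)

unpop₂ : ∀ e l r ts → length ts ≤ e →
         Unpop (suc e) (popped₂ (suc (length ts)) (r ∷ l ∷ ts)) (suc (forestSize (r ∷ l ∷ ts)))
unpop₂ e l r ts len≤ =
  leaves (e ∸ length ts) ++ node₂ l r ∷ ts , length-leaves-++ e (node₂ l r ∷ ts) (s≤s len≤) ,
  trans (forestSize-leaves (e ∸ length ts) (node₂ l r ∷ ts)) (forestSize-node₂ l r ts) ,
  pop-leaves (e ∸ length ts) (node₂ l r ∷ ts)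

decodePopped₂-bar : ∀ {x f} n L e′ ts → not (e′ ≡ᵇ L) ≡ f →
                    decodePopped n x L (popped₂ e′ ts) ≡ (x , f) ∷ decode n (x + (L ∸ e′)) ts
decodePopped₂-bar n L e′ ts refl = refl

unpop-decode : ∀ {e e′ f} x n ts′ → e′ ≤ suc e → (f ≡ true → e′ ≢ suc e) → (e′ ≡ 0 → f ≡ true) →
  length ts′ ≡ suc e′ →
  Σ Forest λ ts → length ts ≡ suc e × forestSize ts ≡ suc (forestSize ts′) ×
    decodePopped n x (suc e) (pop ts) ≡ (x , f) ∷ decode n (x + (suc e ∸ e′)) ts′
unpop-decode {f = false} x n (t ∷ []) _ _ return⇒ refl with return⇒ refl
... | ()
unpop-decode {e} {f = true} x n (t ∷ []) _ _ _ refl with unpop₁ e t [] z≤n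
... | ts , len , size , pop≡ = ts , len , size , cong (decodePopped n x (suc e)) pop≡
unpop-decode {e} {f = true} x n (t ∷ t₁ ∷ ts) e′≤ bar⇒ _ refl
  with unpop₂ e t₁ t ts (≤-pred e′≤)
... | ts″ , len , size , pop≡ = ts″ , len , size ,
  trans (cong (decodePopped n x (suc e)) pop≡)
        (decodePopped₂-bar n (suc e) (suc (length ts)) (t ∷ t₁ ∷ ts)
                           (cong not (≢⇒≡ᵇ≡false (bar⇒ refl))))
unpop-decode {e} {f = false} x n (t ∷ t₁ ∷ ts) e′≤ _ _ refl with suc (length ts) ≟ suc e
... | yes e′≡ with unpop₂ e t₁ t ts (≤-pred (≤-reflexive e′≡))
...   | ts″ , len , size , pop≡ = ts″ , len , size ,
  trans (cong (decodePopped n x (suc e)) pop≡)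
        (decodePopped₂-bar n (suc e) (suc (length ts)) (t ∷ t₁ ∷ ts) (cong not (≡⇒≡ᵇ≡true e′≡)))
unpop-decode {e} {f = false} x n (t ∷ t₁ ∷ ts) e′≤ _ _ refl | no e′≢
  with unpop₁ e t (t₁ ∷ ts) (≤-pred (≤∧≢⇒< e′≤ e′≢))
... | ts″ , len , size , pop≡ = ts″ , len , size , cong (decodePopped n x (suc e)) pop≡

legalStep-nextLetter : ∀ {e a f b} → LegalStep e a f b → a + (suc e ∸ (suc e + a ∸ b)) ≡ b
legalStep-nextLetter {e} {a} {f} {b} (a≤b , b≤ , _) = begin
  a + (suc e ∸ (suc e + a ∸ b))       ≡⟨ cong (λ c → a + (suc e ∸ (suc e + a ∸ c))) (sym b≡a+d) ⟩
  a + (suc e ∸ (suc e + a ∸ (a + d))) ≡⟨ cong (λ s → a + (suc e ∸ s)) slack≡ ⟩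
  a + (suc e ∸ (suc e ∸ d))           ≡⟨ cong (a +_) (m∸[m∸n]≡n d≤) ⟩
  a + d                               ≡⟨ b≡a+d ⟩
  b                                   ∎
  where
  open ≡-Reasoning
  d = b ∸ a
  b≡a+d : a + d ≡ b
  b≡a+d = m+[n∸m]≡n a≤b
  d≤ : d ≤ suc e
  d≤ = subst (d ≤_) (m+n∸n≡m (suc e) a) (∸-monoˡ-≤ a b≤)
  slack≡ : suc e + a ∸ (a + d) ≡ suc e ∸ d
  slack≡ = trans (cong (_∸ (a + d)) (+-comm (suc e) a)) ([m+n]∸[m+o]≡n∸o a (suc e) d)

PQSTail⇒decode : ∀ {e a f} q → PQSTail e a f q →
                 Σ Forest λ ts → length ts ≡ suc e × decode (forestSize ts) a ts ≡ (a , f) ∷ q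
PQSTail⇒decode {e} {a} [] refl =
  leaves (suc e) ++ [] , length-leaves-++ e [] z≤n ,
  cong (λ n → decode n a (leaves (suc e) ++ [])) (forestSize-leaves (suc e) [])
PQSTail⇒decode {e} {a} {f} ((b , g) ∷ q) (step@(a≤b , _ , bar⇒<) , return⇒ , tail) =
  extend (PQSTail⇒decode q tail)
  where
  open ≡-Reasoning
  e′ = suc e + a ∸ b
  e′≤ : e′ ≤ suc e
  e′≤ = subst (e′ ≤_) (m+n∸n≡m (suc e) a) (∸-monoʳ-≤ (suc e + a) a≤b)
  bar⇒ : f ≡ true → e′ ≢ suc e
  bar⇒ bar e′≡ = <⇒≢ (bar⇒< bar) (begin
    a                    ≡⟨ sym (+-identityʳ a) ⟩
    a + 0                ≡⟨ cong (a +_) (sym (n∸n≡0 (suc e))) ⟩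
    a + (suc e ∸ suc e)  ≡⟨ cong (λ s → a + (suc e ∸ s)) (sym e′≡) ⟩
    a + (suc e ∸ e′)     ≡⟨ legalStep-nextLetter step ⟩
    b                    ∎)
  returns : e′ ≡ 0 → f ≡ true
  returns e′≡0 = return⇒ (begin
    b                    ≡⟨ sym (legalStep-nextLetter step) ⟩
    a + (suc e ∸ e′)     ≡⟨ cong (λ s → a + (suc e ∸ s)) e′≡0 ⟩
    a + suc e            ≡⟨ +-comm a (suc e) ⟩
    suc e + a            ∎)
  extend : Σ Forest (λ ts′ → length ts′ ≡ suc e′ ×
                             decode (forestSize ts′) b ts′ ≡ (b , g) ∷ q) →
           Σ Forest (λ ts → length ts ≡ suc e ×
                            decode (forestSize ts) a ts ≡ (a , f) ∷ (b , g) ∷ q)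
  extend (ts′ , len′ , decode≡) with unpop-decode a (forestSize ts′) ts′ e′≤ bar⇒ returns len′
  ... | ts , len , size≡ , decodePopped≡ = ts , len , (begin
    decode (forestSize ts) a ts
      ≡⟨ cong (λ n → decode n a ts) size≡ ⟩
    decodePopped (forestSize ts′) a (length ts) (pop ts)
      ≡⟨ cong (λ L → decodePopped (forestSize ts′) a L (pop ts)) len ⟩
    decodePopped (forestSize ts′) a (suc e) (pop ts)
      ≡⟨ decodePopped≡ ⟩
    (a , f) ∷ decode (forestSize ts′) (a + (suc e ∸ e′)) ts′
      ≡⟨ cong (λ c → (a , f) ∷ decode (forestSize ts′) c ts′) (legalStep-nextLetter step) ⟩
    (a , f) ∷ decode (forestSize ts′) b ts′
      ≡⟨ cong ((a , f) ∷_) decode≡ ⟩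
    (a , f) ∷ (b , g) ∷ q ∎)

leaves-only : ∀ ts → forestSize ts ≡ 0 → ts ≡ leaves (length ts)
leaves-only [] _ = refl
leaves-only (leaf ∷ ts) size≡0 = cong (leaf ∷_) (leaves-only ts size≡0)

pop-injective : ∀ ts ts′ → pop ts ≡ pop ts′ → length ts ≡ length ts′ → ts ≡ ts′
pop-injective [] [] _ _ = refl
pop-injective (leaf ∷ ts) (leaf ∷ ts′) p l = cong (leaf ∷_) (pop-injective ts ts′ p (suc-injective l))
pop-injective (leaf ∷ ts) (node₁ _ ∷ ts′) p l = ⊥-elim $
  <-irrefl (sym (suc-injective l)) (proj₁ (subst (PopSpec _ _) p (pop-spec ts)))
pop-injective (leaf ∷ ts) (node₂ _ _ ∷ ts′) p l = ⊥-elim $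
  <-irrefl (sym (suc-injective l)) (proj₁ (proj₂ (subst (PopSpec _ _) p (pop-spec ts))))
pop-injective (node₁ _ ∷ ts) (leaf ∷ ts′) p l = ⊥-elim $
  <-irrefl (suc-injective l) (proj₁ (subst (PopSpec _ _) (sym p) (pop-spec ts′)))
pop-injective (node₂ _ _ ∷ ts) (leaf ∷ ts′) p l = ⊥-elim $
  <-irrefl (suc-injective l) (proj₁ (proj₂ (subst (PopSpec _ _) (sym p) (pop-spec ts′))))
pop-injective (node₁ _ ∷ ts) (node₁ _ ∷ ts′) refl _ = refl
pop-injective (node₂ _ _ ∷ ts) (node₂ _ _ ∷ ts′) refl _ = refl

∷-decode-injective : ∀ n {x y y′ f f′} ts ts′ →
  (x , f) ∷ decode n y ts ≡ (x , f′) ∷ decode n y′ ts′ →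
  f ≡ f′ × y ≡ y′ × decode n y ts ≡ decode n y′ ts′
∷-decode-injective n {y = y} {y′} ts ts′ eq with ∷-injective eq
... | refl , tails = refl ,
  trans (sym (headLetter-decode n y ts)) (trans (cong headLetter tails) (headLetter-decode n y′ ts′)) ,
  tails

bars-differ : ∀ {e′ L} → 0 < e′ → e′ < L → (e′ ≡ᵇ 0) ≢ not (e′ ≡ᵇ L)
bars-differ {e′} {L} 0<e′ e′<L
  rewrite ≢⇒≡ᵇ≡false (>⇒≢ 0<e′) | ≢⇒≡ᵇ≡false (<⇒≢ e′<L) = λ ()

mutual
  decode-injective : ∀ n x ts ts′ → forestSize ts ≡ n → forestSize ts′ ≡ n → length ts ≡ length ts′ →
                     decode n x ts ≡ decode n x ts′ → ts ≡ ts′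
  decode-injective zero x ts ts′ s s′ l _ =
    trans (leaves-only ts s) (trans (cong leaves l) (sym (leaves-only ts′ s′)))
  decode-injective (suc n) x ts ts′ s s′ l eq = pop-injective ts ts′
    (decodePopped-injective n x (length ts) (pop ts) (pop ts′)
      (subst (λ s → PopSpec (length ts) s (pop ts)) s (pop-spec ts))
      (subst₂ (λ L s → PopSpec L s (pop ts′)) (sym l) s′ (pop-spec ts′))
      (trans eq (cong (λ L → decodePopped n x L (pop ts′)) (sym l))))
    l

  decodePopped-injective : ∀ n x L p p′ → PopSpec L (suc n) p → PopSpec L (suc n) p′ →
                           decodePopped n x L p ≡ decodePopped n x L p′ → p ≡ p′
  decodePopped-injective n x L (popped₁ e′ ts) (popped₁ e″ ts′)
    (e′< , len , s) (e″< , len′ , s′) eq with ∷-decode-injective n ts ts′ eq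
  ... | _ , y≡ , tails with ∸-cancelˡ-≡ (<⇒≤ e′<) (<⇒≤ e″<) (+-cancelˡ-≡ x _ _ y≡)
  ... | refl = cong (popped₁ e′)
    (decode-injective n _ ts ts′ (suc-injective (sym s)) (suc-injective (sym s′))
                      (trans len (sym len′)) tails)
  decodePopped-injective n x L (popped₂ e′ ts) (popped₂ e″ ts′)
    (_ , e′≤ , len , s) (_ , e″≤ , len′ , s′) eq with ∷-decode-injective n ts ts′ eq
  ... | _ , y≡ , tails with ∸-cancelˡ-≡ e′≤ e″≤ (+-cancelˡ-≡ x _ _ y≡)
  ... | refl = cong (popped₂ e′)
    (decode-injective n _ ts ts′ (suc-injective (sym s)) (suc-injective (sym s′))
                      (trans len (sym len′)) tails)
  decodePopped-injective n x L (popped₁ e′ ts) (popped₂ e″ ts′) (e′< , _) (0<e″ , e″≤ , _) eq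
    with ∷-decode-injective n ts ts′ eq
  ... | bar≡ , y≡ , _ with ∸-cancelˡ-≡ (<⇒≤ e′<) e″≤ (+-cancelˡ-≡ x _ _ y≡)
  ... | refl = contradiction bar≡ (bars-differ 0<e″ e′<)
  decodePopped-injective n x L (popped₂ e′ ts) (popped₁ e″ ts′) (0<e′ , e′≤ , _) (e″< , _) eq
    with ∷-decode-injective n ts ts′ eq
  ... | bar≡ , y≡ , _ with ∸-cancelˡ-≡ e′≤ (<⇒≤ e″<) (+-cancelˡ-≡ x _ _ y≡)
  ... | refl = contradiction (sym bar≡) (bars-differ 0<e′ e″<)

treeCode : SchröderTree → Code
treeCode t = decode (size t) 1 (t ∷ [])

forestSize-[_] : ∀ t → forestSize (t ∷ []) ≡ size t
forestSize-[ t ] = +-identityʳ (size t)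

length-treeCode : ∀ t → length (treeCode t) ≡ suc (size t)
length-treeCode t = length-decode (size t) 1 (t ∷ []) forestSize-[ t ]

treeCode-injective : ∀ {t u} → treeCode t ≡ treeCode u → t ≡ u
treeCode-injective {t} {u} eq = ∷-injectiveˡ
  (decode-injective (size t) 1 (t ∷ []) (u ∷ [])
    forestSize-[ t ] (trans forestSize-[ u ] (sym size≡)) refl
    (trans eq (cong (λ n → decode n 1 (u ∷ [])) (sym size≡))))
  where
  size≡ : size t ≡ size u
  size≡ = suc-injective (trans (sym (length-treeCode t)) (trans (cong length eq) (length-treeCode u)))

treeCode-PQSShape : ∀ t → PQSShape (treeCode t)
treeCode-PQSShape t = shape (treeCode t) (headLetter-decode (size t) 1 (t ∷ []))
  (decode-PQSTail (size t) 1 (t ∷ []) 0 refl forestSize-[ t ])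
  where
  shape : ∀ q → headLetter q ≡ 1 → PQSTailFrom 0 q → PQSShape q
  shape (_ ∷ _) head≡1 tail = head≡1 , tail

PQSShape⇒treeCode : ∀ q → PQSShape q → ∃ λ t → treeCode t ≡ q
PQSShape⇒treeCode ((_ , f) ∷ q) (refl , tail) with PQSTail⇒decode q tail
... | t ∷ [] , _ , decode≡ =
  t , trans (cong (λ n → decode n 1 (t ∷ [])) (sym forestSize-[ t ])) decode≡

treeCodes-enumerate : ∀ n → Enumerates (map treeCode (trees n)) (λ q → PQS q × length q ≡ suc n)
treeCodes-enumerate n = map-enumerates treeCode-injective (trees-enumerates n) λ q → mk⇔ (to q) from
  where
  to : ∀ q → PQS q × length q ≡ suc n → ∃ λ t → size t ≡ n × treeCode t ≡ q
  to q (pqs , len) with PQSShape⇒treeCode q (PQS⇒PQSShape q pqs)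
  ... | t , refl = t , suc-injective (trans (sym (length-treeCode t)) len) , refl
  from : ∀ {q} → (∃ λ t → size t ≡ n × treeCode t ≡ q) → PQS q × length q ≡ suc n
  from (t , refl , refl) = PQSShape⇒PQS (treeCode t) (treeCode-PQSShape t) , length-treeCode t

mainTheorem12 : (n : ℕ) → 1 ≤ n →
    Σ (List Code) (λ L →
      Unique L ×
      ((q : Code) → (q ∈ L) ⇔ (PQS q × length q ≡ n)) ×
      length L ≡ schroder (n ∸ 1))
mainTheorem12 (suc n) _ with treeCodes-enumerate n
... | unique , members =
  map treeCode (trees n) , unique , members , trans (length-map treeCode (trees n)) (length-trees n)
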